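{- There exists a solution to $\mathrm{HWP}(18;6,9;1,7)$.
   Context: For integers $M,N \geq 3$ and even $v$, a solution to $\mathrm{HWP}(v;M,N;\alpha,\beta)$ is a decomposition of the edge set of $K_v - F$, for some 1-factor (perfect matching) $F$ of $K_v$, into $\alpha$ $C_M$-factors and $\beta$ $C_N$-factors, where a $C_M$-factor is a spanning subgraph all of whose connected components are cycles of length $M$. -}

module Defs where

open import Data.Nat using (ℕ; suc)
open import Data.Fin using (Fin; toℕ)
open import Data.List using (List; length; lookup)
open import Data.Product using (Σ; _×_; _,_)
open import Data.Sum using (_⊎_; inj₁; inj₂)
open import Data.Unit using (⊤)
open import Relation.Binary.PropositionalEquality using (_≡_; _≢_)
open import Function.Definitions using (Injective)

Edges : ℕ → Set₁
Edges v = Fin v → Fin v → Set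

-- Perfect matching (1-factor) of K_v: a fixed-point-free involution m;
-- its edges are {x , m x}.
record OneFactor (v : ℕ) : Set where
  field
    mate     : Fin v → Fin v
    invol    : ∀ x → mate (mate x) ≡ x
    no-fixed : ∀ x → mate x ≢ x

matchEdges : ∀ {v} → OneFactor v → Edges v
matchEdges F x y = OneFactor.mate F x ≡ y

Next : (M : ℕ) → Fin M → Fin M → Set
Next M i j = (suc (toℕ i) ≡ toℕ j) ⊎ ((suc (toℕ i) ≡ M) × (toℕ j ≡ 0))

-- A cycle of length M in K_v: an injective map Fin M → Fin v,
-- visiting c 0, c 1, ..., c (M-1), back to c 0.
Cycle : ℕ → ℕ → Set
Cycle v M = Σ (Fin M → Fin v) λ c → Injective _≡_ _≡_ c

cycleEdges : ∀ {v M} → Cycle v M → Edges v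
cycleEdges {v} {M} (c , _) x y =
  Σ (Fin M) λ i → Σ (Fin M) λ j → (c i ≡ x) × (c j ≡ y) × (Next M i j ⊎ Next M j i)

record CFactor (v M : ℕ) : Set where
  field
    cycles : List (Cycle v M)
    cover  : ∀ (x : Fin v) →
             Σ (Fin (length cycles)) λ k → Σ (Fin M) λ i →
               (Σ.proj₁ (lookup cycles k) i ≡ x) ×
               (∀ (k' : Fin (length cycles)) (i' : Fin M) →
                  Σ.proj₁ (lookup cycles k') i' ≡ x → (k' ≡ k) × (i' ≡ i))

factorEdges : ∀ {v M} → CFactor v M → Edges v
factorEdges A x y = Σ (Fin (length (CFactor.cycles A))) λ k →
  cycleEdges (lookup (CFactor.cycles A) k) x y

Label : ℕ → ℕ → Set
Label α β = ⊤ ⊎ (Fin α ⊎ Fin β)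

pieceEdges : ∀ {v M N α β} → OneFactor v → (Fin α → CFactor v M) →
             (Fin β → CFactor v N) → Label α β → Edges v
pieceEdges F A B (inj₁ _) = matchEdges F
pieceEdges F A B (inj₂ (inj₁ a)) = factorEdges (A a)
pieceEdges F A B (inj₂ (inj₂ b)) = factorEdges (B b)

record HWP (v M N α β : ℕ) : Set₁ where
  field
    F       : OneFactor v
    Mfactor : Fin α → CFactor v M
    Nfactor : Fin β → CFactor v N
    exactly-one : ∀ (x y : Fin v) → x ≢ y →
      Σ (Label α β) λ l → pieceEdges F Mfactor Nfactor l x y ×
        (∀ (l' : Label α β) → pieceEdges F Mfactor Nfactor l' x y → l' ≡ l)

module Submission where

-- The decomposition is exhibited explicitly: the 1-factor {2i, 2i+1}, one C₆-factor and
-- seven C₉-factors on 18 vertices, together with a colouring of the pairs of vertices by the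
-- nine pieces. Every defining condition is a finite, decidable property of this data,
-- and "each edge lies in exactly one piece" splits into two cheap checks: every edge of
-- a piece has that piece's colour (so the piece is unique), and every edge lies in the
-- piece of its colour (so it exists).

open import Defs
open import Data.Fin using (Fin; toℕ; fromℕ<; #_)
open import Data.Fin.Properties using (_≟_; any?; all?)
open import Data.List using (List; []; _∷_; length; lookup)
open import Data.Nat as ℕ using (ℕ; zero; suc; _∸_; _<?_)
open import Data.Product using (Σ; _×_; _,_; proj₁; proj₂)
open import Data.Sum using (inj₁; inj₂; [_,_])
import Data.Sum.Properties as Sum
open import Data.Unit using (tt)
import Data.Unit.Properties as Unit
open import Data.Vec using (Vec; []; _∷_) renaming (lookup to vlookup)
open import Function using (_∘_)
open import Relation.Binary.Definitions using (Decidable; DecidableEquality)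
open import Relation.Binary.PropositionalEquality using (_≡_; _≢_; refl; sym)
open import Relation.Nullary using (Dec; yes; no; ¬?)
open import Relation.Nullary.Decidable
  using (True; toWitness; from-yes; map′; _×-dec_; _⊎-dec_; _→-dec_)
open import Relation.Unary as U using (Pred)

_≟-Label_ : ∀ {α β} → DecidableEquality (Label α β)
_≟-Label_ = Sum.≡-dec Unit._≟_ (Sum.≡-dec _≟_ _≟_)

allLabel? : ∀ {α β p} {P : Pred (Label α β) p} → U.Decidable P → Dec (∀ l → P l)
allLabel? P? = map′ (λ (p , q , r) → [ (λ _ → p) , [ q , r ] ])
                    (λ f → f (inj₁ tt) , f ∘ inj₂ ∘ inj₁ , f ∘ inj₂ ∘ inj₂)
  (P? (inj₁ tt) ×-dec all? (P? ∘ inj₂ ∘ inj₁) ×-dec all? (P? ∘ inj₂ ∘ inj₂))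

Next? : ∀ M → Decidable (Next M)
Next? M i j =
  (suc (toℕ i) ℕ.≟ toℕ j) ⊎-dec ((suc (toℕ i) ℕ.≟ M) ×-dec (toℕ j ℕ.≟ 0))

cycleEdges? : ∀ {v M} (C : Cycle v M) → Decidable (cycleEdges C)
cycleEdges? {M = M} (c , _) x y =
  any? λ i → any? λ j → (c i ≟ x) ×-dec (c j ≟ y) ×-dec (Next? M i j ⊎-dec Next? M j i)

factorEdges? : ∀ {v M} (A : CFactor v M) → Decidable (factorEdges A)
factorEdges? A x y = any? λ k → cycleEdges? (lookup (CFactor.cycles A) k) x y

matchEdges? : ∀ {v} (F : OneFactor v) → Decidable (matchEdges F)
matchEdges? F x y = OneFactor.mate F x ≟ y

module _ {v M N α β : ℕ} (F : OneFactor v)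
         (A : Fin α → CFactor v M) (B : Fin β → CFactor v N) where

  pieceEdges? : ∀ l → Decidable (pieceEdges F A B l)
  pieceEdges? (inj₁ _)        = matchEdges? F
  pieceEdges? (inj₂ (inj₁ a)) = factorEdges? (A a)
  pieceEdges? (inj₂ (inj₂ b)) = factorEdges? (B b)

injective? : ∀ {v M} (f : Fin M → Fin v) → Dec (∀ i j → f i ≡ f j → i ≡ j)
injective? f = all? λ i → all? λ j → (f i ≟ f j) →-dec (i ≟ j)

cycle : ∀ {v M} (c : Vec (Fin v) M) → {True (injective? (vlookup c))} → Cycle v M
cycle c {inj} = vlookup c , λ {i} {j} → toWitness inj i j

Covers : ∀ {v M} → List (Cycle v M) → Set
Covers {v} {M} cs = ∀ (x : Fin v) →
  Σ (Fin (length cs)) λ k → Σ (Fin M) λ i →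
    (proj₁ (lookup cs k) i ≡ x) ×
    (∀ (k' : Fin (length cs)) (i' : Fin M) →
       proj₁ (lookup cs k') i' ≡ x → (k' ≡ k) × (i' ≡ i))

covers? : ∀ {v M} (cs : List (Cycle v M)) → Dec (Covers cs)
covers? cs = all? λ x → any? λ k → any? λ i → (proj₁ (lookup cs k) i ≟ x) ×-dec
  (all? λ k' → all? λ i' → (proj₁ (lookup cs k') i' ≟ x) →-dec ((k' ≟ k) ×-dec (i' ≟ i)))

factor : ∀ {v M} (cs : List (Cycle v M)) → {True (covers? cs)} → CFactor v M
factor cs {cov} = record { cycles = cs ; cover = toWitness cov }

oneFactor : ∀ {v} (m : Vec (Fin v) v) →
            {True (all? λ x → vlookup m (vlookup m x) ≟ x)} →
            {True (all? λ x → ¬? (vlookup m x ≟ x))} → OneFactor v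
oneFactor m {invol} {no-fixed} = record
  { mate = vlookup m ; invol = toWitness invol ; no-fixed = toWitness no-fixed }

module _ {v ℓ} {L : Set ℓ} (colour : Fin v → Fin v → L) where

  Monochromatic : ∀ {M} → CFactor v M → L → Set ℓ
  Monochromatic {M} A l = ∀ k i j → Next M i j →
    let c = proj₁ (lookup (CFactor.cycles A) k) in
    colour (c i) (c j) ≡ l × colour (c j) (c i) ≡ l

  monochromatic? : DecidableEquality L → ∀ {M} (A : CFactor v M) l → Dec (Monochromatic A l)
  monochromatic? _≟L_ {M} A l = all? λ k → all? λ i → all? λ j → Next? M i j →-dec
    let c = proj₁ (lookup (CFactor.cycles A) k) in
    (colour (c i) (c j) ≟L l) ×-dec (colour (c j) (c i) ≟L l)

  factorEdges-colour : ∀ {M} {A : CFactor v M} {l} → Monochromatic A l →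
                       ∀ {x y} → factorEdges A x y → colour x y ≡ l
  factorEdges-colour mono (k , i , j , refl , refl , inj₁ i→j) = proj₁ (mono k i j i→j)
  factorEdges-colour mono (k , i , j , refl , refl , inj₂ j→i) = proj₂ (mono k j i j→i)

module _ {v M N α β : ℕ} (F : OneFactor v)
         (A : Fin α → CFactor v M) (B : Fin β → CFactor v N)
         (colour : Fin v → Fin v → Label α β) where

  open OneFactor F using (mate)

  PieceColoured : Label α β → Set
  PieceColoured l@(inj₁ _)        = ∀ x → colour x (mate x) ≡ l
  PieceColoured l@(inj₂ (inj₁ a)) = Monochromatic colour (A a) l
  PieceColoured l@(inj₂ (inj₂ b)) = Monochromatic colour (B b) l

  pieceColoured? : ∀ l → Dec (PieceColoured l)
  pieceColoured? l@(inj₁ _)        = all? λ x → colour x (mate x) ≟-Label l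
  pieceColoured? l@(inj₂ (inj₁ a)) = monochromatic? colour _≟-Label_ (A a) l
  pieceColoured? l@(inj₂ (inj₂ b)) = monochromatic? colour _≟-Label_ (B b) l

  pieceEdges-colour : ∀ l → PieceColoured l → ∀ {x y} → pieceEdges F A B l x y → colour x y ≡ l
  pieceEdges-colour (inj₁ _)        coloured refl = coloured _
  pieceEdges-colour (inj₂ (inj₁ a)) coloured      = factorEdges-colour colour {A = A a} coloured
  pieceEdges-colour (inj₂ (inj₂ b)) coloured      = factorEdges-colour colour {A = B b} coloured

  exactly-one-by-colouring :
    (∀ l → PieceColoured l) → (∀ x y → x ≢ y → pieceEdges F A B (colour x y) x y) →
    ∀ x y → x ≢ y → Σ (Label α β) λ l →
      pieceEdges F A B l x y × (∀ l' → pieceEdges F A B l' x y → l' ≡ l)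
  exactly-one-by-colouring coloured inColour x y x≢y =
    colour x y , inColour x y x≢y , λ l' e → sym (pieceEdges-colour l' (coloured l') e)

  coloured? : Dec (∀ l → PieceColoured l)
  coloured? = allLabel? pieceColoured?

  inColour? : Dec (∀ x y → x ≢ y → pieceEdges F A B (colour x y) x y)
  inColour? = all? λ x → all? λ y → ¬? (x ≟ y) →-dec pieceEdges? F A B (colour x y) x y

-- Code 0 is the 1-factor, codes 1 … α the C_M-factors and α + 1 … α + β the C_N-factors;
-- codes beyond that are junk and default to the 1-factor.
labelOf : ∀ {α β} → ℕ → Label α β
labelOf zero = inj₁ tt
labelOf {α} {β} (suc n) with n <? α | n ∸ α <? β
... | yes n<α | _       = inj₂ (inj₁ (fromℕ< n<α))
... | no _    | yes m<β = inj₂ (inj₂ (fromℕ< m<β))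
... | no _    | no _    = inj₁ tt

matching : OneFactor 18
matching = oneFactor (# 1 ∷ # 0 ∷ # 3 ∷ # 2 ∷ # 5 ∷ # 4 ∷ # 7 ∷ # 6 ∷ # 9 ∷ # 8 ∷ # 11 ∷ # 10 ∷ # 13 ∷ # 12 ∷ # 15 ∷ # 14 ∷ # 17 ∷ # 16 ∷ [])

C6-factor : Fin 1 → CFactor 18 6
C6-factor _ = factor
  ( cycle (# 12 ∷ # 15 ∷ # 5 ∷ # 16 ∷ # 8 ∷ # 14 ∷ [])
  ∷ cycle (# 4 ∷ # 13 ∷ # 0 ∷ # 10 ∷ # 1 ∷ # 2 ∷ [])
  ∷ cycle (# 17 ∷ # 6 ∷ # 11 ∷ # 3 ∷ # 9 ∷ # 7 ∷ [])
  ∷ [])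

C9-factor : Fin 7 → CFactor 18 9
C9-factor = vlookup
  ( factor ( cycle (# 0 ∷ # 14 ∷ # 7 ∷ # 13 ∷ # 10 ∷ # 17 ∷ # 5 ∷ # 12 ∷ # 16 ∷ [])
           ∷ cycle (# 1 ∷ # 11 ∷ # 4 ∷ # 3 ∷ # 8 ∷ # 6 ∷ # 2 ∷ # 9 ∷ # 15 ∷ []) ∷ [])
  ∷ factor ( cycle (# 0 ∷ # 2 ∷ # 15 ∷ # 3 ∷ # 17 ∷ # 14 ∷ # 6 ∷ # 5 ∷ # 11 ∷ [])
           ∷ cycle (# 1 ∷ # 9 ∷ # 10 ∷ # 12 ∷ # 7 ∷ # 8 ∷ # 4 ∷ # 16 ∷ # 13 ∷ []) ∷ [])
  ∷ factor ( cycle (# 0 ∷ # 9 ∷ # 13 ∷ # 2 ∷ # 7 ∷ # 5 ∷ # 10 ∷ # 3 ∷ # 12 ∷ [])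
           ∷ cycle (# 1 ∷ # 16 ∷ # 15 ∷ # 6 ∷ # 4 ∷ # 14 ∷ # 11 ∷ # 8 ∷ # 17 ∷ []) ∷ [])
  ∷ factor ( cycle (# 0 ∷ # 8 ∷ # 5 ∷ # 14 ∷ # 9 ∷ # 11 ∷ # 13 ∷ # 17 ∷ # 15 ∷ [])
           ∷ cycle (# 1 ∷ # 4 ∷ # 12 ∷ # 2 ∷ # 16 ∷ # 3 ∷ # 7 ∷ # 10 ∷ # 6 ∷ []) ∷ [])
  ∷ factor ( cycle (# 0 ∷ # 6 ∷ # 16 ∷ # 14 ∷ # 13 ∷ # 15 ∷ # 4 ∷ # 9 ∷ # 17 ∷ [])
           ∷ cycle (# 1 ∷ # 3 ∷ # 5 ∷ # 2 ∷ # 10 ∷ # 8 ∷ # 12 ∷ # 11 ∷ # 7 ∷ []) ∷ [])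
  ∷ factor ( cycle (# 0 ∷ # 5 ∷ # 1 ∷ # 12 ∷ # 9 ∷ # 16 ∷ # 10 ∷ # 4 ∷ # 7 ∷ [])
           ∷ cycle (# 2 ∷ # 14 ∷ # 3 ∷ # 6 ∷ # 13 ∷ # 8 ∷ # 15 ∷ # 11 ∷ # 17 ∷ []) ∷ [])
  ∷ factor ( cycle (# 0 ∷ # 3 ∷ # 13 ∷ # 5 ∷ # 9 ∷ # 6 ∷ # 12 ∷ # 17 ∷ # 4 ∷ [])
           ∷ cycle (# 1 ∷ # 8 ∷ # 2 ∷ # 11 ∷ # 16 ∷ # 7 ∷ # 15 ∷ # 10 ∷ # 14 ∷ []) ∷ [])
  ∷ [])

-- Symmetric; the diagonal entries are never consulted.
colourCode : Vec (Vec ℕ 18) 18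
colourCode =
  (0 ∷ 0 ∷ 3 ∷ 8 ∷ 8 ∷ 7 ∷ 6 ∷ 7 ∷ 5 ∷ 4 ∷ 1 ∷ 3 ∷ 4 ∷ 1 ∷ 2 ∷ 5 ∷ 2 ∷ 6 ∷ [])
  ∷ (0 ∷ 0 ∷ 1 ∷ 6 ∷ 5 ∷ 7 ∷ 5 ∷ 6 ∷ 8 ∷ 3 ∷ 1 ∷ 2 ∷ 7 ∷ 3 ∷ 8 ∷ 2 ∷ 4 ∷ 4 ∷ [])
  ∷ (3 ∷ 1 ∷ 0 ∷ 0 ∷ 1 ∷ 6 ∷ 2 ∷ 4 ∷ 8 ∷ 2 ∷ 6 ∷ 8 ∷ 5 ∷ 4 ∷ 7 ∷ 3 ∷ 5 ∷ 7 ∷ [])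
  ∷ (8 ∷ 6 ∷ 0 ∷ 0 ∷ 2 ∷ 6 ∷ 7 ∷ 5 ∷ 2 ∷ 1 ∷ 4 ∷ 1 ∷ 4 ∷ 8 ∷ 7 ∷ 3 ∷ 5 ∷ 3 ∷ [])
  ∷ (8 ∷ 5 ∷ 1 ∷ 2 ∷ 0 ∷ 0 ∷ 4 ∷ 7 ∷ 3 ∷ 6 ∷ 7 ∷ 2 ∷ 5 ∷ 1 ∷ 4 ∷ 6 ∷ 3 ∷ 8 ∷ [])
  ∷ (7 ∷ 7 ∷ 6 ∷ 6 ∷ 0 ∷ 0 ∷ 3 ∷ 4 ∷ 5 ∷ 8 ∷ 4 ∷ 3 ∷ 2 ∷ 8 ∷ 5 ∷ 1 ∷ 1 ∷ 2 ∷ [])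
  ∷ (6 ∷ 5 ∷ 2 ∷ 7 ∷ 4 ∷ 3 ∷ 0 ∷ 0 ∷ 2 ∷ 8 ∷ 5 ∷ 1 ∷ 8 ∷ 7 ∷ 3 ∷ 4 ∷ 6 ∷ 1 ∷ [])
  ∷ (7 ∷ 6 ∷ 4 ∷ 5 ∷ 7 ∷ 4 ∷ 0 ∷ 0 ∷ 3 ∷ 1 ∷ 5 ∷ 6 ∷ 3 ∷ 2 ∷ 2 ∷ 8 ∷ 8 ∷ 1 ∷ [])
  ∷ (5 ∷ 8 ∷ 8 ∷ 2 ∷ 3 ∷ 5 ∷ 2 ∷ 3 ∷ 0 ∷ 0 ∷ 6 ∷ 4 ∷ 6 ∷ 7 ∷ 1 ∷ 7 ∷ 1 ∷ 4 ∷ [])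
  ∷ (4 ∷ 3 ∷ 2 ∷ 1 ∷ 6 ∷ 8 ∷ 8 ∷ 1 ∷ 0 ∷ 0 ∷ 3 ∷ 5 ∷ 7 ∷ 4 ∷ 5 ∷ 2 ∷ 7 ∷ 6 ∷ [])
  ∷ (1 ∷ 1 ∷ 6 ∷ 4 ∷ 7 ∷ 4 ∷ 5 ∷ 5 ∷ 6 ∷ 3 ∷ 0 ∷ 0 ∷ 3 ∷ 2 ∷ 8 ∷ 8 ∷ 7 ∷ 2 ∷ [])
  ∷ (3 ∷ 2 ∷ 8 ∷ 1 ∷ 2 ∷ 3 ∷ 1 ∷ 6 ∷ 4 ∷ 5 ∷ 0 ∷ 0 ∷ 6 ∷ 5 ∷ 4 ∷ 7 ∷ 8 ∷ 7 ∷ [])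
  ∷ (4 ∷ 7 ∷ 5 ∷ 4 ∷ 5 ∷ 2 ∷ 8 ∷ 3 ∷ 6 ∷ 7 ∷ 3 ∷ 6 ∷ 0 ∷ 0 ∷ 1 ∷ 1 ∷ 2 ∷ 8 ∷ [])
  ∷ (1 ∷ 3 ∷ 4 ∷ 8 ∷ 1 ∷ 8 ∷ 7 ∷ 2 ∷ 7 ∷ 4 ∷ 2 ∷ 5 ∷ 0 ∷ 0 ∷ 6 ∷ 6 ∷ 3 ∷ 5 ∷ [])
  ∷ (2 ∷ 8 ∷ 7 ∷ 7 ∷ 4 ∷ 5 ∷ 3 ∷ 2 ∷ 1 ∷ 5 ∷ 8 ∷ 4 ∷ 1 ∷ 6 ∷ 0 ∷ 0 ∷ 6 ∷ 3 ∷ [])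
  ∷ (5 ∷ 2 ∷ 3 ∷ 3 ∷ 6 ∷ 1 ∷ 4 ∷ 8 ∷ 7 ∷ 2 ∷ 8 ∷ 7 ∷ 1 ∷ 6 ∷ 0 ∷ 0 ∷ 4 ∷ 5 ∷ [])
  ∷ (2 ∷ 4 ∷ 5 ∷ 5 ∷ 3 ∷ 1 ∷ 6 ∷ 8 ∷ 1 ∷ 7 ∷ 7 ∷ 8 ∷ 2 ∷ 3 ∷ 6 ∷ 4 ∷ 0 ∷ 0 ∷ [])
  ∷ (6 ∷ 4 ∷ 7 ∷ 3 ∷ 8 ∷ 2 ∷ 1 ∷ 1 ∷ 4 ∷ 6 ∷ 2 ∷ 7 ∷ 8 ∷ 5 ∷ 3 ∷ 5 ∷ 0 ∷ 0 ∷ [])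
  ∷ []

colour : Fin 18 → Fin 18 → Label 1 7
colour x y = labelOf (vlookup (vlookup colourCode x) y)

lemma16 : HWP 18 6 9 1 7
lemma16 = record
  { F           = matching
  ; Mfactor     = C6-factor
  ; Nfactor     = C9-factor
  ; exactly-one = exactly-one-by-colouring matching C6-factor C9-factor colour
                    (from-yes (coloured? matching C6-factor C9-factor colour))
                    (from-yes (inColour? matching C6-factor C9-factor colour))
  }
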